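{- Let $m \ge 1$ and let $C$ be a binary LCD $[2m+4,3]$ code with $d(C^\perp)\ge 2$. Then there is a $3$-cover $(Y_1,Y_2,Y_3)$ of the $m$-set $X=\{1,\dots,m\}$ such that $C$ is equivalent to $C'((Y_1,Y_2,Y_3))$.
   Context: A $3$-cover of $X$ is a sequence $(Y_1,Y_2,Y_3)$ of (not necessarily distinct) subsets of $X$ with $Y_1\cup Y_2\cup Y_3=X$. For a positive integer $a$ write $a+Y=\{a+y\mid y\in Y\}$. Set $Z_i=\{i\}\cup(3+Y_i)\cup(3+m+Y_i)\subseteq\{1,\dots,2m+3\}$ for $i=1,2,3$, let $z_i\in\mathbb{F}_2^{2m+3}$ be the characteristic vector of $Z_i$, and let $G$ be the $3\times(2m+3)$ matrix with rows $z_1,z_2,z_3$. $C'((Y_1,Y_2,Y_3))$ is the binary $[2m+4,3]$ code generated by the rows of the $3\times(2m+4)$ matrix obtained by appending to $G$ the column $(0,1,1)^T$. A binary $[n,k]$ code is a $k$-dimensional subspace of $\mathbb{F}_2^n$; $C$ is LCD if $C\cap C^\perp=\{\mathbf{0}_n\}$; $d(D)$ is the minimum nonzero Hamming weight of $D$. Two binary codes are equivalent if one is obtained from the other by a permutation of coordinates. -}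

module Defs where

open import Data.Bool using (Bool; true; false; _xor_; if_then_else_)
open import Data.Nat using (ℕ; zero; suc; _+_; _*_; _≤_)
open import Data.Nat.Properties using (+-suc; +-comm; +-assoc)
open import Data.Fin using (Fin)
open import Data.Fin.Permutation using (Permutation′; _⟨$⟩ʳ_)
open import Data.Fin.Subset using (Subset; _∪_; ⊤)
open import Data.Vec using (Vec; []; _∷_; _++_; zipWith; replicate; tabulate; lookup; cast; foldr)
open import Data.Product using (Σ; ∃; _×_; _,_)
open import Function.Bundles using (_⇔_)
open import Relation.Binary.PropositionalEquality using (_≡_; refl; cong; sym; trans)
open import Relation.Nullary using (¬_)

-- Binary words of length n (vectors over F_2, with Bool ≅ F_2, xor = +, ∧ = *)
Word : ℕ → Set
Word n = Vec Bool n

zeroW : ∀ {n} → Word n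
zeroW = replicate _ false

_⊕_ : ∀ {n} → Word n → Word n → Word n
_⊕_ = zipWith _xor_

dot : ∀ {n} → Word n → Word n → Bool
dot [] [] = false
dot (x ∷ xs) (y ∷ ys) = (if x then y else false) xor dot xs ys

weight : ∀ {n} → Word n → ℕ
weight [] = 0
weight (true ∷ xs) = suc (weight xs)
weight (false ∷ xs) = weight xs

lincomb : ∀ {k n} → Vec Bool k → Vec (Word n) k → Word n
lincomb [] [] = zeroW
lincomb (c ∷ cs) (g ∷ gs) = if c then g ⊕ lincomb cs gs else lincomb cs gs

Code : ℕ → Set₁
Code n = Word n → Set

Span : ∀ {k n} → Vec (Word n) k → Code n
Span G w = Σ (Vec Bool _) λ c → w ≡ lincomb c G

LinearlyIndependent : ∀ {k n} → Vec (Word n) k → Set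
LinearlyIndependent G = ∀ c → lincomb c G ≡ zeroW → c ≡ zeroW

IsLinearCode : (n k : ℕ) → Code n → Set
IsLinearCode n k C =
  Σ (Vec (Word n) k) λ G → LinearlyIndependent G × (∀ w → C w ⇔ Span G w)

Dual : ∀ {n} → Code n → Code n
Dual C w = ∀ c → C c → dot c w ≡ false

IsLCD : ∀ {n} → Code n → Set
IsLCD C = ∀ w → C w → Dual C w → w ≡ zeroW

MinDistGE : ∀ {n} → Code n → ℕ → Set
MinDistGE D d = ∀ w → D w → ¬ (w ≡ zeroW) → d ≤ weight w

permute : ∀ {n} → Permutation′ n → Word n → Word n
permute σ w = tabulate λ i → lookup w (σ ⟨$⟩ʳ i)

Equivalent : ∀ {n} → Code n → Code n → Set
Equivalent {n} C D = Σ (Permutation′ n) λ σ → ∀ w → C w ⇔ D (permute σ w)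

-- 3-covers of X = {1..m} (encoded as Fin m, element j+1 ↔ index j)
Is3Cover : ∀ {m} → Subset m → Subset m → Subset m → Set
Is3Cover Y₁ Y₂ Y₃ = (Y₁ ∪ Y₂) ∪ Y₃ ≡ ⊤

len-eq : ∀ m → 3 + (m + (m + 1)) ≡ 2 * m + 4
len-eq m = trans (cong (3 +_) (sym (+-assoc m m 1)))
          (trans (+-comm 3 (m + m + 1))
          (trans (+-assoc (m + m) 1 3)
          (cong (λ x → x + 4) (cong (m +_) (sym (+-comm m 0))))))

-- row i of the generator matrix of C'((Y₁,Y₂,Y₃)):
-- z_i = char. vector of {i} ∪ (3+Y_i) ∪ (3+m+Y_i) in F_2^{2m+3}, followed by entry b_i
-- where (b₁,b₂,b₃) = (0,1,1)
row : ∀ {m} → Vec Bool 3 → Subset m → Bool → Word (2 * m + 4)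
row {m} e Y b = cast (len-eq m) (e ++ (Y ++ (Y ++ (b ∷ []))))

C'gen : ∀ {m} → Subset m → Subset m → Subset m → Vec (Word (2 * m + 4)) 3
C'gen Y₁ Y₂ Y₃ =
    row (true ∷ false ∷ false ∷ []) Y₁ false
  ∷ row (false ∷ true ∷ false ∷ []) Y₂ true
  ∷ row (false ∷ false ∷ true ∷ []) Y₃ true
  ∷ []

C' : ∀ {m} → Subset m → Subset m → Subset m → Code (2 * m + 4)
C' Y₁ Y₂ Y₃ = Span (C'gen Y₁ Y₂ Y₃)

module Submission where

-- A code spanned by a 3-row matrix G is determined by the multiset of columns of G
-- (vectors in F₂³): permuting columns gives an equivalent code, and replacing every
-- column v by Mv for an invertible M gives the same code. Cancel equal columns in
-- pairs: the columns are a set S of columns of odd multiplicity together with a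
-- list Ys of columns taken twice. Because d(C⊥) ≥ 2 no column is zero, because the
-- length is even so is |S|, and because GGᵀ = Σ_{v ∈ S} vvᵀ over F₂, LCD-ness and the
-- independence of the rows make this Gram form nondegenerate. An exhaustive check
-- over the 256 subsets of F₂³ shows that such an S is the image under an invertible
-- M of {e₁, e₂, e₃, (0,1,1)}, the columns of C' not depending on the cover. The
-- columns Ys, pulled back along M, are nonzero, hence the membership vectors of a
-- 3-cover whose code C' has, up to M and a permutation, the columns of G.

open import Defs
open import Algebra.Bundles using (CommutativeRing)
open import Data.Bool using (Bool; true; false; not; _xor_; _∨_; if_then_else_)
open import Data.Bool.Properties using (xor-assoc; xor-same; xor-identityʳ; xor-∧-commutativeRing)
  renaming (_≟_ to _≟ᵇ_)
open import Data.Empty using (⊥-elim)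
open import Data.Fin as Fin using (Fin; zero; suc)
import Data.Fin.Properties as Finₚ
open import Data.Fin.Permutation using (Permutation′; _⟨$⟩ʳ_; _⟨$⟩ˡ_; inverseʳ; flip; _∘ₚ_; cast-id)
open import Data.Fin.Subset using (Subset)
open import Data.List as List using (List; []; _∷_; _++_; [_])
import Data.List.Properties as Listₚ
open import Data.List.Membership.Propositional using (_∈_; _∉_)
open import Data.List.Membership.Propositional.Properties using (∈-++⁺ˡ; ∈-++⁺ʳ; ∈-map⁻)
open import Data.List.Relation.Binary.Permutation.Propositional
  using (_↭_; ↭⇒↭ₛ; ↭-sym; ↭-reflexive; prep; module PermutationReasoning)
  renaming (refl to ↭-refl; trans to ↭-trans)
import Data.List.Relation.Binary.Permutation.Homogeneous as Homogeneous
import Data.List.Relation.Binary.Permutation.Propositional.Properties as Permutationₚ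
import Data.List.Relation.Binary.Permutation.Setoid.Properties as Permutationₛ
open import Data.List.Relation.Unary.Any using (any?; here; there)
open import Data.Nat using (ℕ; zero; suc; _+_; _*_; _≤_; _%_; pred)
open import Data.Nat.DivMod using ([m+kn]%n≡m%n; m*n%n≡0)
open import Data.Nat.Properties
  using (<-irrefl; +-comm; +-identityʳ; +-cancelˡ-≡; *-cancelˡ-≡; *-comm; *-distribˡ-+)
  renaming (_≟_ to _≟ℕ_)
open import Data.Product using (Σ; ∃; _×_; _,_; proj₁; proj₂)
import Data.Product.Properties as Productₚ
open import Data.Sum using (_⊎_; inj₁; inj₂)
open import Data.Unit using (tt)
open import Data.Vec as Vec
  using (Vec; []; _∷_; map; lookup; toList; transpose; replicate; zipWith; cast; _⊛_)
import Data.Vec.Properties as Vecₚ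
open import Data.Vec.Membership.Propositional.Properties using (∈-toList⁻)
open import Data.Vec.Relation.Binary.Pointwise.Extensional using (ext; Pointwise-≡⇒≡)
open import Data.Vec.Relation.Unary.Any using (index)
open import Data.Vec.Relation.Unary.Any.Properties using (lookup-index)
open import Function.Bundles using (_⇔_; mk⇔; Equivalence)
open import Function.Construct.Symmetry using (⇔-sym)
open import Function.Definitions using (StrictlySurjective)
open import Function.Related.Propositional using (module EquationalReasoning)
open import Relation.Binary.Definitions using (DecidableEquality)
open import Relation.Binary.PropositionalEquality
  using (_≡_; refl; sym; trans; cong; cong₂; subst; setoid; module ≡-Reasoning)
open import Relation.Nullary using (¬_)
open import Relation.Nullary.Decidable
  using (Dec; map′; _×-dec_; _⊎-dec_; ¬?; decidable-stable; toWitness)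

open import Algebra.Properties.CommutativeSemigroup
  (CommutativeRing.+-commutativeSemigroup xor-∧-commutativeRing) using (interchange)

-- Transposition and permutations of vectors

lookup-extensional : ∀ {A : Set} {n} {xs ys : Vec A n} → (∀ i → lookup xs i ≡ lookup ys i) → xs ≡ ys
lookup-extensional eq = Pointwise-≡⇒≡ (ext eq)

lookup-transpose : ∀ {A : Set} {k n} (G : Vec (Vec A n) k) j →
                   lookup (transpose G) j ≡ map (λ g → lookup g j) G
lookup-transpose [] j = Vecₚ.lookup-replicate j []
lookup-transpose {n = n} (g ∷ G) j = begin
  lookup (replicate n Vec._∷_ ⊛ g ⊛ transpose G) j
    ≡⟨ Vecₚ.lookup-⊛ j (replicate n Vec._∷_ ⊛ g) (transpose G) ⟩
  lookup (replicate n Vec._∷_ ⊛ g) j (lookup (transpose G) j)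
    ≡⟨ cong₂ (λ f x → f x) (trans (Vecₚ.lookup-⊛ j (replicate n Vec._∷_) g)
                                   (cong (λ f → f (lookup g j)) (Vecₚ.lookup-replicate j Vec._∷_)))
                            (lookup-transpose G j) ⟩
  lookup g j ∷ map (λ g → lookup g j) G ∎
  where open ≡-Reasoning

transpose-∷ : ∀ {A : Set} {k n} (g : Vec A n) (G : Vec (Vec A n) k) →
              transpose (g ∷ G) ≡ zipWith Vec._∷_ g (transpose G)
transpose-∷ g G = sym (Vecₚ.zipWith-is-⊛ Vec._∷_ g (transpose G))

transpose-involutive : ∀ {A : Set} {k n} (G : Vec (Vec A n) k) → transpose (transpose G) ≡ G
transpose-involutive G = lookup-extensional λ j → lookup-extensional λ i → begin
  lookup (lookup (transpose (transpose G)) j) i     ≡⟨ cong (λ r → lookup r i) (lookup-transpose (transpose G) j) ⟩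
  lookup (map (λ r → lookup r j) (transpose G)) i   ≡⟨ Vecₚ.lookup-map i (λ r → lookup r j) (transpose G) ⟩
  lookup (lookup (transpose G) i) j                 ≡⟨ cong (λ r → lookup r j) (lookup-transpose G i) ⟩
  lookup (map (λ g → lookup g i) G) j               ≡⟨ Vecₚ.lookup-map j (λ g → lookup g i) G ⟩
  lookup (lookup G j) i                             ∎
  where open ≡-Reasoning

replicate-+ : ∀ {A : Set} m n (x : A) → replicate (m + n) x ≡ replicate m x Vec.++ replicate n x
replicate-+ zero n x = refl
replicate-+ (suc m) n x = cong (x ∷_) (replicate-+ m n x)

transpose-zipWith-++ : ∀ {A : Set} {k m n} (G : Vec (Vec A m) k) (H : Vec (Vec A n) k) →
                       transpose (zipWith Vec._++_ G H) ≡ transpose G Vec.++ transpose H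
transpose-zipWith-++ {m = m} {n} [] [] = replicate-+ m n []
transpose-zipWith-++ (g ∷ G) (h ∷ H) = begin
  transpose ((g Vec.++ h) ∷ zipWith Vec._++_ G H)
    ≡⟨ transpose-∷ (g Vec.++ h) (zipWith Vec._++_ G H) ⟩
  zipWith Vec._∷_ (g Vec.++ h) (transpose (zipWith Vec._++_ G H))
    ≡⟨ cong (zipWith Vec._∷_ (g Vec.++ h)) (transpose-zipWith-++ G H) ⟩
  zipWith Vec._∷_ (g Vec.++ h) (transpose G Vec.++ transpose H)
    ≡⟨ Vecₚ.zipWith-++ Vec._∷_ g h (transpose G) (transpose H) ⟩
  zipWith Vec._∷_ g (transpose G) Vec.++ zipWith Vec._∷_ h (transpose H)
    ≡⟨ cong₂ Vec._++_ (transpose-∷ g G) (transpose-∷ h H) ⟨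
  transpose (g ∷ G) Vec.++ transpose (h ∷ H) ∎
  where open ≡-Reasoning

transpose-map-cast : ∀ {A : Set} {k m n} .(eq : m ≡ n) (G : Vec (Vec A m) k) →
                     transpose (map (cast eq) G) ≡ cast eq (transpose G)
transpose-map-cast eq G = lookup-extensional λ j → begin
  lookup (transpose (map (cast eq) G)) j               ≡⟨ lookup-transpose (map (cast eq) G) j ⟩
  map (λ g → lookup g j) (map (cast eq) G)             ≡⟨ Vecₚ.map-∘ (λ g → lookup g j) (cast eq) G ⟨
  map (λ g → lookup (cast eq g) j) G                   ≡⟨ Vecₚ.map-cong (λ g → Vecₚ.lookup-cast₁ eq g j) G ⟩
  map (λ g → lookup g (Fin.cast (sym eq) j)) G         ≡⟨ lookup-transpose G (Fin.cast (sym eq) j) ⟨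
  lookup (transpose G) (Fin.cast (sym eq) j)           ≡⟨ Vecₚ.lookup-cast₁ eq (transpose G) j ⟨
  lookup (cast eq (transpose G)) j                     ∎
  where open ≡-Reasoning

toList-cast : ∀ {A : Set} {m n} .(eq : m ≡ n) (xs : Vec A m) → toList (cast eq xs) ≡ toList xs
toList-cast {n = zero} eq [] = refl
toList-cast {n = suc n} eq (x ∷ xs) = cong (x List.∷_) (toList-cast (cong pred eq) xs)

lookup-toList : ∀ {A : Set} {n} (v : Vec A n) i .(eq : n ≡ List.length (toList v)) →
                List.lookup (toList v) (Fin.cast eq i) ≡ lookup v i
lookup-toList (x ∷ v) zero eq = refl
lookup-toList (x ∷ v) (suc i) eq = lookup-toList v i (cong pred eq)

↭⇒permutation : ∀ {A : Set} {n} (xs ys : Vec A n) → toList xs ↭ toList ys →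
                Σ (Permutation′ n) λ σ → ∀ i → lookup ys i ≡ lookup xs (σ ⟨$⟩ʳ i)
↭⇒permutation {A} {n} xs ys xs↭ys = σ , ys≡xs∘σ
  where
  π = Homogeneous.onIndices (↭⇒↭ₛ xs↭ys)
  n≡|ys| : n ≡ List.length (toList ys)
  n≡|ys| = sym (Vecₚ.length-toList ys)
  |xs|≡n : List.length (toList xs) ≡ n
  |xs|≡n = Vecₚ.length-toList xs
  σ : Permutation′ n
  σ = cast-id n≡|ys| ∘ₚ flip π ∘ₚ cast-id |xs|≡n
  ys≡xs∘σ : ∀ i → lookup ys i ≡ lookup xs (σ ⟨$⟩ʳ i)
  ys≡xs∘σ i = begin
    lookup ys i                                   ≡⟨ lookup-toList ys i n≡|ys| ⟨
    List.lookup (toList ys) (Fin.cast n≡|ys| i)   ≡⟨ cong (List.lookup (toList ys)) (inverseʳ π) ⟨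
    List.lookup (toList ys) (π ⟨$⟩ʳ j)            ≡⟨ Permutationₛ.onIndices-lookup (setoid A) (↭⇒↭ₛ xs↭ys) j ⟨
    List.lookup (toList xs) j
      ≡⟨ cong (List.lookup (toList xs)) (Finₚ.cast-involutive (sym |xs|≡n) |xs|≡n j) ⟨
    List.lookup (toList xs) (Fin.cast (sym |xs|≡n) (Fin.cast |xs|≡n j))
                                                  ≡⟨ lookup-toList xs _ (sym |xs|≡n) ⟩
    lookup xs (σ ⟨$⟩ʳ i)                          ∎
    where
    open ≡-Reasoning
    j = π ⟨$⟩ˡ Fin.cast n≡|ys| i

-- The code spanned by a matrix, read off its columns

dot-zeroʳ : ∀ {n} (x : Word n) → dot x zeroW ≡ false
dot-zeroʳ [] = refl
dot-zeroʳ (true ∷ x) = dot-zeroʳ x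
dot-zeroʳ (false ∷ x) = dot-zeroʳ x

dot-comm : ∀ {n} (x y : Word n) → dot x y ≡ dot y x
dot-comm [] [] = refl
dot-comm (true ∷ x) (true ∷ y) = cong not (dot-comm x y)
dot-comm (true ∷ x) (false ∷ y) = dot-comm x y
dot-comm (false ∷ x) (true ∷ y) = dot-comm x y
dot-comm (false ∷ x) (false ∷ y) = dot-comm x y

dot-⊕ʳ : ∀ {n} (c x y : Word n) → dot c (x ⊕ y) ≡ dot c x xor dot c y
dot-⊕ʳ [] [] [] = refl
dot-⊕ʳ (true ∷ c) (x ∷ xs) (y ∷ ys) =
  trans (cong ((x xor y) xor_) (dot-⊕ʳ c xs ys)) (interchange x y (dot c xs) (dot c ys))
dot-⊕ʳ (false ∷ c) (_ ∷ xs) (_ ∷ ys) = dot-⊕ʳ c xs ys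

lincomb-zeroˡ : ∀ {k n} (M : Vec (Word n) k) → lincomb zeroW M ≡ zeroW
lincomb-zeroˡ [] = refl
lincomb-zeroˡ (_ ∷ M) = lincomb-zeroˡ M

dot-lincomb : ∀ {k n} (c : Word n) (v : Word k) (M : Vec (Word n) k) →
              dot c (lincomb v M) ≡ dot v (map (dot c) M)
dot-lincomb c [] [] = dot-zeroʳ c
dot-lincomb c (true ∷ v) (g ∷ M) =
  trans (dot-⊕ʳ c g (lincomb v M)) (cong (dot c g xor_) (dot-lincomb c v M))
dot-lincomb c (false ∷ v) (_ ∷ M) = dot-lincomb c v M

lookup-lincomb : ∀ {k n} (c : Word k) (G : Vec (Word n) k) j →
                 lookup (lincomb c G) j ≡ dot c (map (λ g → lookup g j) G)
lookup-lincomb [] [] j = Vecₚ.lookup-replicate j false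
lookup-lincomb (true ∷ c) (g ∷ G) j =
  trans (Vecₚ.lookup-zipWith _xor_ j g (lincomb c G)) (cong (lookup g j xor_) (lookup-lincomb c G j))
lookup-lincomb (false ∷ c) (_ ∷ G) j = lookup-lincomb c G j

lincomb-transpose : ∀ {k n} (c : Word k) (G : Vec (Word n) k) →
                    lincomb c G ≡ map (dot c) (transpose G)
lincomb-transpose c G = lookup-extensional λ j → begin
  lookup (lincomb c G) j                ≡⟨ lookup-lincomb c G j ⟩
  dot c (map (λ g → lookup g j) G)      ≡⟨ cong (dot c) (lookup-transpose G j) ⟨
  dot c (lookup (transpose G) j)        ≡⟨ Vecₚ.lookup-map j (dot c) (transpose G) ⟨
  lookup (map (dot c) (transpose G)) j  ∎
  where open ≡-Reasoning

ColumnCode : ∀ {k n} → Vec (Word k) n → Code n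
ColumnCode L w = ∃ λ c → w ≡ map (dot c) L

span⇔columnCode : ∀ {k n} (G : Vec (Word n) k) w → Span G w ⇔ ColumnCode (transpose G) w
span⇔columnCode G w = mk⇔ (λ (c , w≡) → c , trans w≡ (lincomb-transpose c G))
                          (λ (c , w≡) → c , trans w≡ (sym (lincomb-transpose c G)))

map-dot-lincomb : ∀ {k n} (M : Vec (Word k) k) c (L : Vec (Word k) n) →
                  map (dot c) (map (λ v → lincomb v M) L) ≡ map (dot (map (dot c) M)) L
map-dot-lincomb M c L = trans (sym (Vecₚ.map-∘ (dot c) (λ v → lincomb v M) L))
  (Vecₚ.map-cong (λ v → trans (dot-lincomb c v M) (dot-comm v (map (dot c) M))) L)

columnCode-lincomb : ∀ {k n} (M : Vec (Word k) k) (L : Vec (Word k) n) →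
                     StrictlySurjective _≡_ (λ c → map (dot c) M) →
                     ∀ w → ColumnCode (map (λ v → lincomb v M) L) w ⇔ ColumnCode L w
columnCode-lincomb M L Mᵀ-onto w = mk⇔
  (λ (c , w≡) → map (dot c) M , trans w≡ (map-dot-lincomb M c L))
  (λ (c , w≡) → let (a , Mᵀa≡c) = Mᵀ-onto c in
     a , trans w≡ (trans (cong (λ c → map (dot c) L) (sym Mᵀa≡c)) (sym (map-dot-lincomb M a L))))

permute-map : ∀ {A : Set} {n} (σ : Permutation′ n) (L T : Vec A n) →
              (∀ i → lookup T i ≡ lookup L (σ ⟨$⟩ʳ i)) →
              ∀ (f : A → Bool) → permute σ (map f L) ≡ map f T
permute-map σ L T T≡L∘σ f = lookup-extensional λ i → begin
  lookup (permute σ (map f L)) i  ≡⟨ Vecₚ.lookup∘tabulate (λ i → lookup (map f L) (σ ⟨$⟩ʳ i)) i ⟩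
  lookup (map f L) (σ ⟨$⟩ʳ i)     ≡⟨ Vecₚ.lookup-map (σ ⟨$⟩ʳ i) f L ⟩
  f (lookup L (σ ⟨$⟩ʳ i))         ≡⟨ cong f (T≡L∘σ i) ⟨
  f (lookup T i)                  ≡⟨ Vecₚ.lookup-map i f T ⟨
  lookup (map f T) i              ∎
  where open ≡-Reasoning

permute-injective : ∀ {n} (σ : Permutation′ n) {w w′ : Word n} → permute σ w ≡ permute σ w′ → w ≡ w′
permute-injective σ {w} {w′} eq = lookup-extensional λ j → begin
  lookup w j                          ≡⟨ cong (lookup w) (inverseʳ σ) ⟨
  lookup w (σ ⟨$⟩ʳ (σ ⟨$⟩ˡ j))        ≡⟨ Vecₚ.lookup∘tabulate (λ i → lookup w (σ ⟨$⟩ʳ i)) (σ ⟨$⟩ˡ j) ⟨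
  lookup (permute σ w) (σ ⟨$⟩ˡ j)     ≡⟨ cong (λ x → lookup x (σ ⟨$⟩ˡ j)) eq ⟩
  lookup (permute σ w′) (σ ⟨$⟩ˡ j)    ≡⟨ Vecₚ.lookup∘tabulate (λ i → lookup w′ (σ ⟨$⟩ʳ i)) (σ ⟨$⟩ˡ j) ⟩
  lookup w′ (σ ⟨$⟩ʳ (σ ⟨$⟩ˡ j))       ≡⟨ cong (lookup w′) (inverseʳ σ) ⟩
  lookup w′ j                         ∎
  where open ≡-Reasoning

columnCode-permute : ∀ {k n} (σ : Permutation′ n) (L T : Vec (Word k) n) →
                     (∀ i → lookup T i ≡ lookup L (σ ⟨$⟩ʳ i)) →
                     ∀ w → ColumnCode L w ⇔ ColumnCode T (permute σ w)
columnCode-permute σ L T T≡L∘σ w = mk⇔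
  (λ (c , w≡) → c , trans (cong (permute σ) w≡) (permute-map σ L T T≡L∘σ (dot c)))
  (λ (c , σw≡) → c , permute-injective σ (trans σw≡ (sym (permute-map σ L T T≡L∘σ (dot c)))))

equivalent-by-columns : ∀ {k n} (C : Code n) (G G′ : Vec (Word n) k) (M : Vec (Word k) k) →
  (∀ w → C w ⇔ Span G w) → StrictlySurjective _≡_ (λ c → map (dot c) M) →
  toList (transpose G) ↭ List.map (λ v → lincomb v M) (toList (transpose G′)) →
  Equivalent C (Span G′)
equivalent-by-columns C G G′ M C⇔G Mᵀ-onto L↭MT = σ , C⇔G′∘σ
  where
  L = transpose G
  T = transpose G′
  MT = map (λ v → lincomb v M) T
  σ,MT≡L∘σ = ↭⇒permutation L MT (↭-trans L↭MT (↭-reflexive (sym (Vecₚ.toList-map _ T))))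
  σ = proj₁ σ,MT≡L∘σ
  C⇔G′∘σ : ∀ w → C w ⇔ Span G′ (permute σ w)
  C⇔G′∘σ w = begin
    C w                              ∼⟨ C⇔G w ⟩
    Span G w                         ∼⟨ span⇔columnCode G w ⟩
    ColumnCode L w                   ∼⟨ columnCode-permute σ L MT (proj₂ σ,MT≡L∘σ) w ⟩
    ColumnCode MT (permute σ w)      ∼⟨ columnCode-lincomb M T Mᵀ-onto (permute σ w) ⟩
    ColumnCode T (permute σ w)       ∼⟨ ⇔-sym (span⇔columnCode G′ (permute σ w)) ⟩
    Span G′ (permute σ w)            ∎
    where open EquationalReasoning

-- Zero columns and the Gram form

unit : ∀ {n} → Fin n → Word n
unit zero = true ∷ zeroW
unit (suc j) = false ∷ unit j

dot-unit : ∀ {n} (x : Word n) j → dot x (unit j) ≡ lookup x j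
dot-unit (true ∷ x) zero = cong not (dot-zeroʳ x)
dot-unit (false ∷ x) zero = dot-zeroʳ x
dot-unit (true ∷ x) (suc j) = dot-unit x j
dot-unit (false ∷ x) (suc j) = dot-unit x j

weight-unit : ∀ {n} (j : Fin n) → weight (unit j) ≡ 1
weight-unit {suc n} zero = cong suc (weight-zeroW n)
  where
  weight-zeroW : ∀ n → weight (zeroW {n}) ≡ 0
  weight-zeroW zero = refl
  weight-zeroW (suc n) = weight-zeroW n
weight-unit (suc j) = weight-unit j

unit≢zeroW : ∀ {n} (j : Fin n) → ¬ unit j ≡ zeroW
unit≢zeroW zero ()
unit≢zeroW (suc j) eq = unit≢zeroW j (cong Vec.tail eq)

zeroColumn⇒unit∈dual : ∀ {k n} (C : Code n) (G : Vec (Word n) k) → (∀ w → C w ⇔ Span G w) →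
                       ∀ j → lookup (transpose G) j ≡ zeroW → Dual C (unit j)
zeroColumn⇒unit∈dual C G C⇔G j Lj≡0 c c∈C
  with Equivalence.to (span⇔columnCode G c) (Equivalence.to (C⇔G c) c∈C)
... | a , refl = begin
  dot (map (dot a) L) (unit j)   ≡⟨ dot-unit (map (dot a) L) j ⟩
  lookup (map (dot a) L) j       ≡⟨ Vecₚ.lookup-map j (dot a) L ⟩
  dot a (lookup L j)             ≡⟨ cong (dot a) Lj≡0 ⟩
  dot a zeroW                    ≡⟨ dot-zeroʳ a ⟩
  false                          ∎
  where
  open ≡-Reasoning
  L = transpose G

zeroW∉columns : ∀ {k n} (C : Code n) (G : Vec (Word n) k) → (∀ w → C w ⇔ Span G w) →
                MinDistGE (Dual C) 2 → zeroW ∉ toList (transpose G)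
zeroW∉columns C G C⇔G d⊥≥2 0∈L = <-irrefl refl (subst (2 ≤_) (weight-unit j)
  (d⊥≥2 (unit j) (zeroColumn⇒unit∈dual C G C⇔G j Lj≡0) (unit≢zeroW j)))
  where
  0∈L′ = ∈-toList⁻ 0∈L
  j = index 0∈L′
  Lj≡0 = sym (lookup-index 0∈L′)

xorSum : List Bool → Bool
xorSum = List.foldr _xor_ false

xorSum-↭ : ∀ {xs ys} → xs ↭ ys → xorSum xs ≡ xorSum ys
xorSum-↭ xs↭ys = Permutationₛ.foldr-commMonoid (setoid Bool)
  (CommutativeRing.+-isCommutativeMonoid xor-∧-commutativeRing) (↭⇒↭ₛ xs↭ys)

xorSum-++ : ∀ xs ys → xorSum (xs ++ ys) ≡ xorSum xs xor xorSum ys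
xorSum-++ [] ys = refl
xorSum-++ (x ∷ xs) ys =
  trans (cong (x xor_) (xorSum-++ xs ys)) (sym (xor-assoc x (xorSum xs) (xorSum ys)))

-- aᵀ (Σ_{v ∈ vs} vvᵀ) b; on the columns of G it is the Gram form aᵀ G Gᵀ b.
gram : ∀ {k} → Word k → Word k → List (Word k) → Bool
gram a b vs = xorSum (List.map (λ v → if dot a v then dot b v else false) vs)

dot-map-dot : ∀ {k n} (a b : Word k) (L : Vec (Word k) n) →
              dot (map (dot a) L) (map (dot b) L) ≡ gram a b (toList L)
dot-map-dot a b [] = refl
dot-map-dot a b (v ∷ L) = cong ((if dot a v then dot b v else false) xor_) (dot-map-dot a b L)

gram-↭ : ∀ {k} (a b : Word k) {vs us} → vs ↭ us → gram a b vs ≡ gram a b us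
gram-↭ a b vs↭us = xorSum-↭ (Permutationₚ.map⁺ _ vs↭us)

gram-++ : ∀ {k} (a b : Word k) vs us → gram a b (vs ++ us) ≡ gram a b vs xor gram a b us
gram-++ a b vs us =
  trans (cong xorSum (Listₚ.map-++ ab vs us)) (xorSum-++ (List.map ab vs) (List.map ab us))
  where ab = λ v → if dot a v then dot b v else false

gram-++-doubled : ∀ {k} (a b : Word k) vs us → gram a b (vs ++ us ++ us) ≡ gram a b vs
gram-++-doubled a b vs us = begin
  gram a b (vs ++ us ++ us)                     ≡⟨ gram-++ a b vs (us ++ us) ⟩
  gram a b vs xor gram a b (us ++ us)           ≡⟨ cong (gram a b vs xor_) (gram-++ a b us us) ⟩
  gram a b vs xor (gram a b us xor gram a b us) ≡⟨ cong (gram a b vs xor_) (xor-same (gram a b us)) ⟩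
  gram a b vs xor false                         ≡⟨ xor-identityʳ (gram a b vs) ⟩
  gram a b vs                                   ∎
  where open ≡-Reasoning

gram-nondegenerate : ∀ {k n} (C : Code n) (G : Vec (Word n) k) → (∀ w → C w ⇔ Span G w) →
                     LinearlyIndependent G → IsLCD C →
                     ∀ b → (∀ a → gram a b (toList (transpose G)) ≡ false) → b ≡ zeroW
gram-nondegenerate C G C⇔G indep lcd b b∈radical = indep b (lcd (lincomb b G) bG∈C bG∈C⊥)
  where
  L = transpose G
  bG∈C : C (lincomb b G)
  bG∈C = Equivalence.from (C⇔G _) (b , refl)
  bG∈C⊥ : Dual C (lincomb b G)
  bG∈C⊥ c c∈C with Equivalence.to (span⇔columnCode G c) (Equivalence.to (C⇔G c) c∈C)
  ... | a , refl = begin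
    dot (map (dot a) L) (lincomb b G)          ≡⟨ cong (dot (map (dot a) L)) (lincomb-transpose b G) ⟩
    dot (map (dot a) L) (map (dot b) L)        ≡⟨ dot-map-dot a b L ⟩
    gram a b (toList L)                        ≡⟨ b∈radical a ⟩
    false                                      ∎
    where open ≡-Reasoning

-- Pairing off equal columns

-- A subset of F₂ⁿ as its indicator table; the first component lists words starting with true.
WordSet : ℕ → Set
WordSet zero = Bool
WordSet (suc n) = WordSet n × WordSet n

∅ : ∀ {n} → WordSet n
∅ {zero} = false
∅ {suc n} = ∅ , ∅

elements : ∀ {n} → WordSet n → List (Word n)
elements {zero} b = if b then [ [] ] else []
elements {suc n} (S₁ , S₀) = List.map (true ∷_) (elements S₁) ++ List.map (false ∷_) (elements S₀)

member : ∀ {n} → Word n → WordSet n → Bool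
member [] b = b
member (true ∷ v) (S₁ , _) = member v S₁
member (false ∷ v) (_ , S₀) = member v S₀

toggle : ∀ {n} → Word n → WordSet n → WordSet n
toggle [] b = not b
toggle (true ∷ v) (S₁ , S₀) = toggle v S₁ , S₀
toggle (false ∷ v) (S₁ , S₀) = S₁ , toggle v S₀

elements-∅ : ∀ n → elements (∅ {n}) ≡ []
elements-∅ zero = refl
elements-∅ (suc n) =
  cong₂ (λ E₁ E₀ → List.map (true ∷_) E₁ ++ List.map (false ∷_) E₀) (elements-∅ n) (elements-∅ n)

toggle-absent : ∀ {n} (v : Word n) S → member v S ≡ false → elements (toggle v S) ↭ v ∷ elements S
toggle-absent [] false _ = ↭-refl
toggle-absent (true ∷ v) (S₁ , S₀) v∉S =
  Permutationₚ.++⁺ʳ _ (Permutationₚ.map⁺ (true ∷_) (toggle-absent v S₁ v∉S))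
toggle-absent (false ∷ v) (S₁ , S₀) v∉S =
  ↭-trans (Permutationₚ.++⁺ˡ _ (Permutationₚ.map⁺ (false ∷_) (toggle-absent v S₀ v∉S)))
          (Permutationₚ.shift (false ∷ v) _ _)

toggle-present : ∀ {n} (v : Word n) S → member v S ≡ true → elements S ↭ v ∷ elements (toggle v S)
toggle-present [] true _ = ↭-refl
toggle-present (true ∷ v) (S₁ , S₀) v∈S =
  Permutationₚ.++⁺ʳ _ (Permutationₚ.map⁺ (true ∷_) (toggle-present v S₁ v∈S))
toggle-present (false ∷ v) (S₁ , S₀) v∈S =
  ↭-trans (Permutationₚ.++⁺ˡ _ (Permutationₚ.map⁺ (false ∷_) (toggle-present v S₀ v∈S)))
          (Permutationₚ.shift (false ∷ v) _ _)

pairOff : ∀ {n} → List (Word n) → WordSet n × List (Word n)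
pairOff [] = ∅ , []
pairOff (v ∷ vs) with pairOff vs
... | S , ys = toggle v S , (if member v S then v ∷ ys else ys)

∷-doubled : ∀ {A : Set} (v : A) xs ys → v ∷ v ∷ xs ++ ys ++ ys ↭ xs ++ (v ∷ ys) ++ (v ∷ ys)
∷-doubled v xs ys = ↭-sym (begin
  xs ++ v ∷ ys ++ v ∷ ys       ↭⟨ Permutationₚ.shift v xs (ys ++ v ∷ ys) ⟩
  v ∷ xs ++ ys ++ v ∷ ys       ≡⟨ cong (v ∷_) (Listₚ.++-assoc xs ys (v ∷ ys)) ⟨
  v ∷ (xs ++ ys) ++ v ∷ ys     ↭⟨ prep v (Permutationₚ.shift v (xs ++ ys) ys) ⟩
  v ∷ v ∷ (xs ++ ys) ++ ys     ≡⟨ cong (λ zs → v ∷ v ∷ zs) (Listₚ.++-assoc xs ys ys) ⟩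
  v ∷ v ∷ xs ++ ys ++ ys       ∎)
  where
  open PermutationReasoning

↭-pairOff : ∀ {n} (vs : List (Word n)) →
            vs ↭ elements (proj₁ (pairOff vs)) ++ proj₂ (pairOff vs) ++ proj₂ (pairOff vs)
↭-pairOff {n} [] = ↭-reflexive (sym (cong (List._++ []) (elements-∅ n)))
↭-pairOff (v ∷ vs) with pairOff vs | ↭-pairOff vs
... | S , ys | vs↭ with member v S in v∈?S
... | false = ↭-trans (prep v vs↭) (↭-sym (Permutationₚ.++⁺ʳ (ys ++ ys) (toggle-absent v S v∈?S)))
... | true = ↭-trans (prep v (↭-trans vs↭ (Permutationₚ.++⁺ʳ (ys ++ ys) (toggle-present v S v∈?S))))
                     (∷-doubled v (elements (toggle v S)) ys)

pairOff≡⇒↭elements : ∀ {n} (vs : List (Word n)) {S} → pairOff vs ≡ (S , []) → vs ↭ elements S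
pairOff≡⇒↭elements vs {S} pairOff≡ = ↭-trans
  (subst (λ p → vs ↭ elements (proj₁ p) ++ proj₂ p ++ proj₂ p) pairOff≡ (↭-pairOff vs))
  (↭-reflexive (Listₚ.++-identityʳ (elements S)))

length-↭-doubled : ∀ {A : Set} {xs : List A} E Ys → xs ↭ E ++ Ys ++ Ys →
                   List.length E + (List.length Ys + List.length Ys) ≡ List.length xs
length-↭-doubled E Ys xs↭ = sym (trans (Permutationₚ.↭-length xs↭)
  (trans (Listₚ.length-++ E) (cong (List.length E +_) (Listₚ.length-++ Ys))))

a+[k+k]≡2m+4⇒a%2≡0 : ∀ m a k → a + (k + k) ≡ 2 * m + 4 → a % 2 ≡ 0
a+[k+k]≡2m+4⇒a%2≡0 m a k a+2k≡ = begin
  a % 2               ≡⟨ [m+kn]%n≡m%n a k 2 ⟨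
  (a + k * 2) % 2     ≡⟨ cong (λ x → (a + x) % 2) (trans (*-comm k 2) (cong (k +_) (+-identityʳ k))) ⟩
  (a + (k + k)) % 2   ≡⟨ cong (_% 2) a+2k≡ ⟩
  (2 * m + 4) % 2     ≡⟨ cong (_% 2) (trans (sym (*-distribˡ-+ 2 m 2)) (*-comm 2 (m + 2))) ⟩
  ((m + 2) * 2) % 2   ≡⟨ m*n%n≡0 (m + 2) 2 ⟩
  0                   ∎
  where open ≡-Reasoning

4+[k+k]≡2m+4⇒k≡m : ∀ m k → 4 + (k + k) ≡ 2 * m + 4 → k ≡ m
4+[k+k]≡2m+4⇒k≡m m k 4+2k≡ = *-cancelˡ-≡ k m 2
  (trans (cong (k +_) (+-identityʳ k)) (+-cancelˡ-≡ 4 (k + k) (2 * m) (trans 4+2k≡ (+-comm (2 * m) 4))))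

length-↭-doubled-half : ∀ {A : Set} m {xs : List A} E Ys → xs ↭ E ++ Ys ++ Ys →
                        List.length xs ≡ 2 * m + 4 → List.length E ≡ 4 → List.length Ys ≡ m
length-↭-doubled-half m E Ys xs↭ |xs|≡ |E|≡4 = 4+[k+k]≡2m+4⇒k≡m m (List.length Ys)
  (trans (cong (_+ _) (sym |E|≡4)) (trans (length-↭-doubled E Ys xs↭) |xs|≡))

-- The columns of C'

e₁ e₂ e₃ e₂₃ : Word 3
e₁ = true ∷ false ∷ false ∷ []
e₂ = false ∷ true ∷ false ∷ []
e₃ = false ∷ false ∷ true ∷ []
e₂₃ = false ∷ true ∷ true ∷ []

C'-fixedColumns : List (Word 3)
C'-fixedColumns = e₁ ∷ e₂ ∷ e₃ ∷ [ e₂₃ ]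

membershipColumns : ∀ {m} → Subset m → Subset m → Subset m → Vec (Word 3) m
membershipColumns Y₁ Y₂ Y₃ = transpose (Y₁ ∷ Y₂ ∷ Y₃ ∷ [])

transpose-C'gen : ∀ {m} (Y₁ Y₂ Y₃ : Subset m) → let Yᵀ = membershipColumns Y₁ Y₂ Y₃ in
                  transpose (C'gen Y₁ Y₂ Y₃) ≡ cast (len-eq m) (e₁ ∷ e₂ ∷ e₃ ∷ Yᵀ Vec.++ (Yᵀ Vec.++ e₂₃ ∷ []))
transpose-C'gen {m} Y₁ Y₂ Y₃ = begin
  transpose (map (cast (len-eq m)) (zipWith Vec._++_ E (zipWith Vec._++_ Y YB)))
    ≡⟨ transpose-map-cast (len-eq m) (zipWith Vec._++_ E (zipWith Vec._++_ Y YB)) ⟩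
  cast (len-eq m) (transpose (zipWith Vec._++_ E (zipWith Vec._++_ Y YB)))
    ≡⟨ cong (cast (len-eq m)) (transpose-zipWith-++ E (zipWith Vec._++_ Y YB)) ⟩
  cast (len-eq m) (transpose E Vec.++ transpose (zipWith Vec._++_ Y YB))
    ≡⟨ cong (λ T → cast (len-eq m) (transpose E Vec.++ T)) (transpose-zipWith-++ Y YB) ⟩
  cast (len-eq m) (transpose E Vec.++ transpose Y Vec.++ transpose YB)
    ≡⟨ cong (λ T → cast (len-eq m) (transpose E Vec.++ transpose Y Vec.++ T)) (transpose-zipWith-++ Y B) ⟩
  cast (len-eq m) (transpose E Vec.++ transpose Y Vec.++ transpose Y Vec.++ transpose B) ∎
  where
  E = e₁ ∷ e₂ ∷ e₃ ∷ []
  Y = Y₁ ∷ Y₂ ∷ Y₃ ∷ []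
  B = (false ∷ []) ∷ (true ∷ []) ∷ (true ∷ []) ∷ []
  YB = zipWith Vec._++_ Y B
  open ≡-Reasoning

toList-C'gen : ∀ {m} (Y₁ Y₂ Y₃ : Subset m) → let Ys = toList (membershipColumns Y₁ Y₂ Y₃) in
               toList (transpose (C'gen Y₁ Y₂ Y₃)) ↭ C'-fixedColumns ++ Ys ++ Ys
toList-C'gen {m} Y₁ Y₂ Y₃ = begin
  toList (transpose (C'gen Y₁ Y₂ Y₃))
    ≡⟨ cong toList (transpose-C'gen Y₁ Y₂ Y₃) ⟩
  toList (cast (len-eq m) (e₁ ∷ e₂ ∷ e₃ ∷ Yᵀ Vec.++ (Yᵀ Vec.++ e₂₃ ∷ [])))
    ≡⟨ toList-cast (len-eq m) _ ⟩
  e₁ ∷ e₂ ∷ e₃ ∷ toList (Yᵀ Vec.++ (Yᵀ Vec.++ e₂₃ ∷ []))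
    ≡⟨ cong (λ zs → e₁ ∷ e₂ ∷ e₃ ∷ zs) (trans (Vecₚ.toList-++ Yᵀ _) (cong (Ys ++_) (Vecₚ.toList-++ Yᵀ _))) ⟩
  e₁ ∷ e₂ ∷ e₃ ∷ Ys ++ Ys ++ [ e₂₃ ]
    ≡⟨ cong (λ zs → e₁ ∷ e₂ ∷ e₃ ∷ zs) (Listₚ.++-assoc Ys Ys [ e₂₃ ]) ⟨
  e₁ ∷ e₂ ∷ e₃ ∷ (Ys ++ Ys) ++ [ e₂₃ ]
    ↭⟨ prep e₁ (prep e₂ (prep e₃ (Permutationₚ.++-comm (Ys ++ Ys) [ e₂₃ ]))) ⟩
  C'-fixedColumns ++ Ys ++ Ys ∎
  where
  open PermutationReasoning
  Yᵀ = membershipColumns Y₁ Y₂ Y₃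
  Ys = toList Yᵀ

nonzero⇒covered : ∀ a b c → ¬ zeroW ≡ a ∷ b ∷ c ∷ [] → (a ∨ b) ∨ c ≡ true
nonzero⇒covered true _ _ _ = refl
nonzero⇒covered false true _ _ = refl
nonzero⇒covered false false true _ = refl
nonzero⇒covered false false false v≢0 = ⊥-elim (v≢0 refl)

is3Cover : ∀ {m} (Y₁ Y₂ Y₃ : Subset m) → zeroW ∉ toList (membershipColumns Y₁ Y₂ Y₃) →
           Is3Cover Y₁ Y₂ Y₃
is3Cover [] [] [] _ = refl
is3Cover (a ∷ Y₁) (b ∷ Y₂) (c ∷ Y₃) 0∉ = cong₂ _∷_
  (nonzero⇒covered a b c (λ 0≡v → 0∉ (here 0≡v))) (is3Cover Y₁ Y₂ Y₃ (λ 0∈ → 0∉ (there 0∈)))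

membershipColumns-surjective : ∀ {m} (Ys : List (Word 3)) → List.length Ys ≡ m →
                               Σ (Subset m) λ Y₁ → Σ (Subset m) λ Y₂ → Σ (Subset m) λ Y₃ →
                                 toList (membershipColumns Y₁ Y₂ Y₃) ≡ Ys
membershipColumns-surjective Ys refl
  with transpose (Vec.fromList Ys) | transpose-involutive (Vec.fromList Ys)
... | Y₁ ∷ Y₂ ∷ Y₃ ∷ [] | Yᵀᵀ≡Ys = Y₁ , Y₂ , Y₃ , trans (cong toList Yᵀᵀ≡Ys) (Vecₚ.toList∘fromList Ys)

-- Classification of the odd part of the columns

Searchable : Set → Set₁
Searchable A = ∀ {P : A → Set} → (∀ x → Dec (P x)) → Dec (∃ P)

search-Bool : Searchable Bool
search-Bool P? = map′ (λ { (inj₁ p) → true , p ; (inj₂ p) → false , p })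
                      (λ { (true , p) → inj₁ p ; (false , p) → inj₂ p })
                      (P? true ⊎-dec P? false)

search-× : ∀ {A B} → Searchable A → Searchable B → Searchable (A × B)
search-× search-A search-B P? =
  map′ (λ (a , b , p) → (a , b) , p) (λ ((a , b) , p) → a , b , p)
       (search-A λ a → search-B λ b → P? (a , b))

search-Vec : ∀ {A} → Searchable A → ∀ n → Searchable (Vec A n)
search-Vec search-A zero P? = map′ ([] ,_) (λ { ([] , p) → p }) (P? [])
search-Vec search-A (suc n) P? =
  map′ (λ (x , xs , p) → x ∷ xs , p) (λ { (x ∷ xs , p) → x , xs , p })
       (search-A λ x → search-Vec search-A n λ xs → P? (x ∷ xs))

search-Word : ∀ n → Searchable (Word n)
search-Word = search-Vec search-Bool

search-WordSet : ∀ n → Searchable (WordSet n)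
search-WordSet zero = search-Bool
search-WordSet (suc n) = search-× (search-WordSet n) (search-WordSet n)

all? : ∀ {A} → Searchable A → ∀ {P : A → Set} → (∀ x → Dec (P x)) → Dec (∀ x → P x)
all? search-A P? = map′ (λ ∄¬P x → decidable-stable (P? x) (λ ¬Px → ∄¬P (x , ¬Px)))
                        (λ ∀P (x , ¬Px) → ¬Px (∀P x))
                        (¬? (search-A λ x → ¬? (P? x)))

_≟ʷ_ : ∀ {n} → DecidableEquality (Word n)
_≟ʷ_ = Vecₚ.≡-dec _≟ᵇ_

_≟ˢ_ : ∀ {n} → DecidableEquality (WordSet n)
_≟ˢ_ {zero} = _≟ᵇ_
_≟ˢ_ {suc n} = Productₚ.≡-dec _≟ˢ_ _≟ˢ_

Degenerate : ∀ {k} → List (Word k) → Set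
Degenerate vs = ∃ λ b → ¬ b ≡ zeroW × (∀ a → gram a b vs ≡ false)

-- The two surjectivity conditions both say that M is invertible; each is used on its own.
ImageOfFixedColumns : WordSet 3 → Set
ImageOfFixedColumns S = Σ (Vec (Word 3) 3) λ M →
  pairOff (List.map (λ v → lincomb v M) C'-fixedColumns) ≡ (S , []) ×
  StrictlySurjective _≡_ (λ v → lincomb v M) × StrictlySurjective _≡_ (λ c → map (dot c) M)

Classification : WordSet 3 → Set
Classification S =
  zeroW ∈ elements S ⊎ List.length (elements S) % 2 ≡ 1 ⊎ Degenerate (elements S) ⊎ ImageOfFixedColumns S

classification? : ∀ S → Dec (Classification S)
classification? S =
  any? (zeroW ≟ʷ_) (elements S) ⊎-dec
  List.length (elements S) % 2 ≟ℕ 1 ⊎-dec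
  search-Word 3 (λ b → ¬? (b ≟ʷ zeroW) ×-dec all? (search-Word 3) λ a → gram a b (elements S) ≟ᵇ false) ⊎-dec
  search-Vec (search-Word 3) 3 (λ M →
    Productₚ.≡-dec _≟ˢ_ (Listₚ.≡-dec _≟ʷ_) (pairOff (List.map (λ v → lincomb v M) C'-fixedColumns)) (S , []) ×-dec
    all? (search-Word 3) (λ y → search-Word 3 λ x → lincomb x M ≟ʷ y) ×-dec
    all? (search-Word 3) (λ c → search-Word 3 λ a → map (dot a) M ≟ʷ c))

-- Evaluated over all 256 subsets of F₂³ by the type checker.
classification : ∀ S → Classification S
classification = toWitness {a? = all? (search-WordSet 3) classification?} tt

EquivalentToSomeC' : (m : ℕ) → Code (2 * m + 4) → Set
EquivalentToSomeC' m C = Σ (Subset m) λ Y₁ → Σ (Subset m) λ Y₂ → Σ (Subset m) λ Y₃ →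
  Is3Cover Y₁ Y₂ Y₃ × Equivalent C (C' Y₁ Y₂ Y₃)

zeroW∉map-section : ∀ {k} (M : Vec (Word k) k) (A : Word k → Word k) → (∀ y → lincomb (A y) M ≡ y) →
                    ∀ {ys} → zeroW ∉ ys → zeroW ∉ List.map A ys
zeroW∉map-section M A MA≡id {ys} 0∉ys 0∈Ays with ∈-map⁻ A 0∈Ays
... | y , y∈ys , 0≡Ay = 0∉ys (subst (_∈ ys) y≡0 y∈ys)
  where
  y≡0 : y ≡ zeroW
  y≡0 = trans (sym (MA≡id y)) (trans (cong (λ x → lincomb x M) (sym 0≡Ay)) (lincomb-zeroˡ M))

imageOfFixedColumns⇒C' : ∀ m (C : Code (2 * m + 4)) (G : Vec (Word (2 * m + 4)) 3) →
  (∀ w → C w ⇔ Span G w) → zeroW ∉ toList (transpose G) →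
  ∀ S Ys → toList (transpose G) ↭ elements S ++ Ys ++ Ys → ImageOfFixedColumns S →
  EquivalentToSomeC' m C
imageOfFixedColumns⇒C' m C G C⇔G 0∉L S Ys L↭ (M , pairOff≡ , B-onto , Mᵀ-onto) =
  let Y₁ , Y₂ , Y₃ , Yᵀ≡Ys′ = membershipColumns-surjective Ys′ |Ys′|≡m in
  Y₁ , Y₂ , Y₃ , is3Cover Y₁ Y₂ Y₃ (subst (zeroW ∉_) (sym Yᵀ≡Ys′) 0∉Ys′) ,
  equivalent-by-columns C G (C'gen Y₁ Y₂ Y₃) M C⇔G Mᵀ-onto (L↭BT Y₁ Y₂ Y₃ Yᵀ≡Ys′)
  where
  B = λ v → lincomb v M
  A = λ y → proj₁ (B-onto y)
  Ys′ = List.map A Ys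
  BYs′≡Ys : List.map B Ys′ ≡ Ys
  BYs′≡Ys = trans (sym (Listₚ.map-∘ Ys))
    (trans (Listₚ.map-cong (λ y → proj₂ (B-onto y)) Ys) (Listₚ.map-id Ys))
  BF↭S = pairOff≡⇒↭elements (List.map B C'-fixedColumns) pairOff≡
  |Ys′|≡m : List.length Ys′ ≡ m
  |Ys′|≡m = trans (Listₚ.length-map A Ys) (length-↭-doubled-half m (elements S) Ys L↭
    (Vecₚ.length-toList (transpose G))
    (trans (sym (Permutationₚ.↭-length BF↭S)) (Listₚ.length-map B C'-fixedColumns)))
  0∉Ys′ : zeroW ∉ Ys′
  0∉Ys′ = zeroW∉map-section M A (λ y → proj₂ (B-onto y))
    (λ 0∈Ys → 0∉L (Permutationₚ.∈-resp-↭ (↭-sym L↭) (∈-++⁺ʳ (elements S) (∈-++⁺ˡ 0∈Ys))))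
  L↭BT : ∀ Y₁ Y₂ Y₃ → toList (membershipColumns Y₁ Y₂ Y₃) ≡ Ys′ →
         toList (transpose G) ↭ List.map B (toList (transpose (C'gen Y₁ Y₂ Y₃)))
  L↭BT Y₁ Y₂ Y₃ Yᵀ≡Ys′ = begin
    toList (transpose G)
      ↭⟨ L↭ ⟩
    elements S ++ Ys ++ Ys
      ≡⟨ cong (λ zs → elements S ++ zs ++ zs) BYs′≡Ys ⟨
    elements S ++ List.map B Ys′ ++ List.map B Ys′
      ↭⟨ Permutationₚ.++⁺ʳ _ (↭-sym BF↭S) ⟩
    List.map B C'-fixedColumns ++ List.map B Ys′ ++ List.map B Ys′
      ≡⟨ trans (Listₚ.map-++ B C'-fixedColumns (Ys′ ++ Ys′))
               (cong (List.map B C'-fixedColumns ++_) (Listₚ.map-++ B Ys′ Ys′)) ⟨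
    List.map B (C'-fixedColumns ++ Ys′ ++ Ys′)
      ≡⟨ cong (λ zs → List.map B (C'-fixedColumns ++ zs ++ zs)) Yᵀ≡Ys′ ⟨
    List.map B (C'-fixedColumns ++ Yᵀ ++ Yᵀ)
      ↭⟨ Permutationₚ.map⁺ B (↭-sym (toList-C'gen Y₁ Y₂ Y₃)) ⟩
    List.map B (toList (transpose (C'gen Y₁ Y₂ Y₃))) ∎
    where
    open PermutationReasoning
    Yᵀ = toList (membershipColumns Y₁ Y₂ Y₃)

proposition3p6 : (m : ℕ) → 1 ≤ m → (C : Code (2 * m + 4)) →
    IsLinearCode (2 * m + 4) 3 C → IsLCD C → MinDistGE (Dual C) 2 →
    Σ (Subset m) λ Y₁ → Σ (Subset m) λ Y₂ → Σ (Subset m) λ Y₃ →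
      Is3Cover Y₁ Y₂ Y₃ × Equivalent C (C' Y₁ Y₂ Y₃)
proposition3p6 m _ C (G , indep , C⇔G) lcd d⊥≥2 = fromClassification (classification S)
  where
  L = toList (transpose G)
  S = proj₁ (pairOff L)
  Ys = proj₂ (pairOff L)
  L↭ : L ↭ elements S ++ Ys ++ Ys
  L↭ = ↭-pairOff L
  0∉L = zeroW∉columns C G C⇔G d⊥≥2
  fromClassification : Classification S → EquivalentToSomeC' m C
  fromClassification (inj₁ 0∈S) = ⊥-elim (0∉L (Permutationₚ.∈-resp-↭ (↭-sym L↭) (∈-++⁺ˡ 0∈S)))
  fromClassification (inj₂ (inj₁ |S|-odd)) = ⊥-elim (0≢1 (trans (sym |S|-even) |S|-odd))
    where
    0≢1 : ¬ 0 ≡ 1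
    0≢1 ()
    |S|-even = a+[k+k]≡2m+4⇒a%2≡0 m (List.length (elements S)) (List.length Ys)
      (trans (length-↭-doubled (elements S) Ys L↭) (Vecₚ.length-toList (transpose G)))
  fromClassification (inj₂ (inj₂ (inj₁ (b , b≢0 , b∈radical)))) =
    ⊥-elim (b≢0 (gram-nondegenerate C G C⇔G indep lcd b λ a →
      trans (gram-↭ a b L↭) (trans (gram-++-doubled a b (elements S) Ys) (b∈radical a))))
  fromClassification (inj₂ (inj₂ (inj₂ image))) = imageOfFixedColumns⇒C' m C G C⇔G 0∉L S Ys L↭ image
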